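{- Let $n\ge 1$, let $\pi=\pi_1\pi_2\ldots\pi_n\in\mathcal{DU}_n(4123)$ and let $a$ be a positive integer with $a\le\pi_1$. Then $\pi'=a\rightarrow\pi$ is in $\mathcal{UD}_{n+1}(4123)$.
   Context: A permutation $\pi=\pi_1\cdots\pi_m$ of $[m]=\{1,\ldots,m\}$ is down-up alternating if $\pi_1>\pi_2<\pi_3>\pi_4<\cdots$ and up-down alternating if $\pi_1<\pi_2>\pi_3<\pi_4>\cdots$. It avoids the pattern $4123$ if no subsequence $\pi_{i_1}\pi_{i_2}\pi_{i_3}\pi_{i_4}$ ($i_1<i_2<i_3<i_4$) satisfies $\pi_{i_2}<\pi_{i_3}<\pi_{i_4}<\pi_{i_1}$. $\mathcal{DU}_m(4123)$ and $\mathcal{UD}_m(4123)$ denote the sets of $4123$-avoiding down-up, respectively up-down, alternating permutations of $[m]$. For a permutation $\pi$ of $[n]$ and $a\in[n+1]$, $a\rightarrow\pi$ is the unique permutation $\pi'$ of $[n+1]$ with $\pi'_1=a$ and $\pi'_2\cdots\pi'_{n+1}$ order-isomorphic to $\pi$. -}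

module Defs where

open import Data.Nat using (ℕ; suc; _%_)
open import Data.Fin using (Fin; zero; suc; toℕ; punchIn; _<_)
open import Data.Fin.Permutation using (Permutation′; _⟨$⟩ʳ_)
open import Data.Product using (_×_; ∃-syntax)
open import Relation.Binary.PropositionalEquality using (_≡_)
open import Relation.Nullary using (¬_)

-- Permutations of [m] are bijections Fin m ↔ Fin m; positions and values are
-- 0-based (value v : Fin m stands for v+1 ∈ [m]; position i stands for i+1).

-- down-up: π₁ > π₂ < π₃ > ... ; 0-based position i even ⇒ descent at i.
DownUp : ∀ {m} → Permutation′ m → Set
DownUp {m} π = ∀ (i j : Fin m) → toℕ j ≡ suc (toℕ i) →
  (toℕ i % 2 ≡ 0 → π ⟨$⟩ʳ j < π ⟨$⟩ʳ i) × (toℕ i % 2 ≡ 1 → π ⟨$⟩ʳ i < π ⟨$⟩ʳ j)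

UpDown : ∀ {m} → Permutation′ m → Set
UpDown {m} π = ∀ (i j : Fin m) → toℕ j ≡ suc (toℕ i) →
  (toℕ i % 2 ≡ 0 → π ⟨$⟩ʳ i < π ⟨$⟩ʳ j) × (toℕ i % 2 ≡ 1 → π ⟨$⟩ʳ j < π ⟨$⟩ʳ i)

Contains4123 : ∀ {m} → Permutation′ m → Set
Contains4123 {m} π = ∃[ i₁ ] ∃[ i₂ ] ∃[ i₃ ] ∃[ i₄ ]
  ((i₁ < i₂) × (i₂ < i₃) × (i₃ < i₄) ×
   (π ⟨$⟩ʳ i₂ < π ⟨$⟩ʳ i₃) × (π ⟨$⟩ʳ i₃ < π ⟨$⟩ʳ i₄) × (π ⟨$⟩ʳ i₄ < π ⟨$⟩ʳ i₁))

Avoids4123 : ∀ {m} → Permutation′ m → Set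
Avoids4123 π = ¬ Contains4123 π

-- a → π as a function: first entry a, then the entries of π with every value
-- ≥ a shifted up by one (punchIn a), so the tail is order-isomorphic to π.
prepend : ∀ {n} → Fin (suc n) → Permutation′ n → Fin (suc n) → Fin (suc n)
prepend a π zero    = a
prepend a π (suc i) = punchIn a (π ⟨$⟩ʳ i)

module Submission where

-- Because punchIn a is strictly monotone, the tail of π′ has exactly the
-- relative order of π; because a ≤ π₁, the first tail entry exceeds a,
-- while any tail entry below a comes from an entry of π below a ≤ π₁.
-- Hence
--   * π′ is up-down: π′₁ < π′₂ by the head comparison, and every later
--     adjacent pair inherits the order of π one position earlier, where the
--     parity flips (down-up at i becomes up-down at i+1);
--   * π′ avoids 4123: an occurrence inside the tail is one in π, and an
--     occurrence starting at π′₁ cannot use π′₂ (which exceeds π′₁), so it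
--     uses later entries, and replacing π′₁ by π₁ ≥ a gives one in π.

open import Defs
open import Data.Nat using (ℕ; suc; _≤_; _%_; z≤n; s≤s)
import Data.Nat as ℕ
open import Data.Nat.DivMod using (%-pred-≡0)
import Data.Nat.Properties as ℕ
open import Data.Fin using (Fin; zero; suc; toℕ; punchIn; _<_)
import Data.Fin.Properties as Fin
open import Data.Fin.Permutation using (Permutation′; _⟨$⟩ʳ_; insert; insert-punchIn)
open import Data.Product using (Σ; _×_; _,_; proj₁; proj₂)
open import Relation.Binary.PropositionalEquality using (_≡_; refl; sym; subst₂)

pred-parity-even : ∀ n → suc n % 2 ≡ 0 → n % 2 ≡ 1
pred-parity-even n = %-pred-≡0 {n} {2}

pred-parity-odd : ∀ n → suc n % 2 ≡ 1 → n % 2 ≡ 0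
pred-parity-odd ℕ.zero          _ = refl
pred-parity-odd (suc ℕ.zero)    ()
pred-parity-odd (suc (suc n))   e = pred-parity-odd n e

punchIn-mono-< : ∀ {n} (a : Fin (suc n)) {j k : Fin n} → j < k → punchIn a j < punchIn a k
punchIn-mono-< a {j} {k} j<k = Fin.≤∧≢⇒<
  (Fin.punchIn-mono-≤ a j k (ℕ.<⇒≤ j<k))
  (λ eq → Fin.<⇒≢ j<k (Fin.punchIn-injective a j k eq))

punchIn-cancel-< : ∀ {n} (a : Fin (suc n)) {j k : Fin n} → punchIn a j < punchIn a k → j < k
punchIn-cancel-< a {j} {k} lt = ℕ.≰⇒> λ k≤j → ℕ.<⇒≱ lt (Fin.punchIn-mono-≤ a k j k≤j)

punchIn-above : ∀ {n} (a : Fin (suc n)) (v : Fin n) → toℕ a ≤ toℕ v → a < punchIn a v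
punchIn-above zero    v       _         = s≤s z≤n
punchIn-above (suc a) (suc v) (s≤s a≤v) = s≤s (punchIn-above a v a≤v)

punchIn-below : ∀ {n} (a : Fin (suc n)) (v : Fin n) → punchIn a v < a → toℕ v ℕ.< toℕ a
punchIn-below (suc a) zero    _         = s≤s z≤n
punchIn-below (suc a) (suc v) (s≤s lt)  = s≤s (punchIn-below a v lt)

module Prepended {k} (a : Fin (suc (suc k))) (π : Permutation′ (suc k))
                 (ρ : Permutation′ (suc (suc k)))
                 (ρ≗ : ∀ i → ρ ⟨$⟩ʳ i ≡ prepend a π i) where

  ρ-<⁺ : ∀ {i j} → prepend a π i < prepend a π j → ρ ⟨$⟩ʳ i < ρ ⟨$⟩ʳ j
  ρ-<⁺ {i} {j} = subst₂ _<_ (sym (ρ≗ i)) (sym (ρ≗ j))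

  ρ-<⁻ : ∀ {i j} → ρ ⟨$⟩ʳ i < ρ ⟨$⟩ʳ j → prepend a π i < prepend a π j
  ρ-<⁻ {i} {j} = subst₂ _<_ (ρ≗ i) (ρ≗ j)

  tail-<⁺ : ∀ {i j} → π ⟨$⟩ʳ i < π ⟨$⟩ʳ j → ρ ⟨$⟩ʳ suc i < ρ ⟨$⟩ʳ suc j
  tail-<⁺ lt = ρ-<⁺ (punchIn-mono-< a lt)

  tail-<⁻ : ∀ {i j} → ρ ⟨$⟩ʳ suc i < ρ ⟨$⟩ʳ suc j → π ⟨$⟩ʳ i < π ⟨$⟩ʳ j
  tail-<⁻ lt = punchIn-cancel-< a (ρ-<⁻ lt)

  head<second : toℕ a ≤ toℕ (π ⟨$⟩ʳ zero) → ρ ⟨$⟩ʳ zero < ρ ⟨$⟩ʳ suc zero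
  head<second a≤π₁ = ρ-<⁺ (punchIn-above a (π ⟨$⟩ʳ zero) a≤π₁)

  below-head : ∀ {i} → ρ ⟨$⟩ʳ suc i < ρ ⟨$⟩ʳ zero → toℕ (π ⟨$⟩ʳ i) ℕ.< toℕ a
  below-head lt = punchIn-below a _ (ρ-<⁻ lt)

  -- Prepending a ≤ π₁ to a down-up permutation gives an up-down one: the
  -- first step rises, and each later step copies a step of π whose
  -- position has the opposite parity.
  upDown : toℕ a ≤ toℕ (π ⟨$⟩ʳ zero) → DownUp π → UpDown ρ
  upDown a≤π₁ du zero    (suc zero)    refl = (λ _ → head<second a≤π₁) , λ ()
  upDown a≤π₁ du (suc i) (suc j)       eq   =
    (λ odd  → tail-<⁺ (proj₂ (du i j eq′) (pred-parity-even (toℕ i) odd))) ,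
    (λ even → tail-<⁺ (proj₁ (du i j eq′) (pred-parity-odd  (toℕ i) even)))
    where eq′ = ℕ.suc-injective eq

  -- A 4123 occurrence in ρ yields one in π: inside the tail it transfers
  -- directly; starting at the head it must skip ρ's second entry (which
  -- exceeds the head), and then π₁ ≥ a can replace the head.
  avoids : toℕ a ≤ toℕ (π ⟨$⟩ʳ zero) → Avoids4123 π → Avoids4123 ρ
  avoids a≤π₁ av (zero , suc zero , i₃ , i₄ , _ , _ , _ , v₂₃ , v₃₄ , v₄₁) =
    Fin.<-asym (head<second a≤π₁) (Fin.<-trans v₂₃ (Fin.<-trans v₃₄ v₄₁))
  avoids a≤π₁ av (zero , suc (suc j₂) , suc j₃ , suc j₄ , _ , s≤s p₂₃ , s≤s p₃₄ , v₂₃ , v₃₄ , v₄₁) =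
    av (zero , suc j₂ , j₃ , j₄ , s≤s z≤n , p₂₃ , p₃₄ ,
        tail-<⁻ v₂₃ , tail-<⁻ v₃₄ , ℕ.<-≤-trans (below-head v₄₁) a≤π₁)
  avoids a≤π₁ av (suc j₁ , suc j₂ , suc j₃ , suc j₄ , s≤s p₁₂ , s≤s p₂₃ , s≤s p₃₄ , v₂₃ , v₃₄ , v₄₁) =
    av (j₁ , j₂ , j₃ , j₄ , p₁₂ , p₂₃ , p₃₄ , tail-<⁻ v₂₃ , tail-<⁻ v₃₄ , tail-<⁻ v₄₁)

prepend-perm : ∀ {n} → Fin (suc n) → Permutation′ n → Permutation′ (suc n)
prepend-perm = insert zero

prepend-perm-≗ : ∀ {n} (a : Fin (suc n)) (π : Permutation′ n) i →
                 prepend-perm a π ⟨$⟩ʳ i ≡ prepend a π i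
prepend-perm-≗ a π zero    = refl
prepend-perm-≗ a π (suc i) = insert-punchIn zero a π i

lemma3p1 : (k : ℕ) (π : Permutation′ (suc k)) → DownUp π → Avoids4123 π →
    (a : Fin (suc (suc k))) → toℕ a ≤ toℕ (π ⟨$⟩ʳ zero) →
    Σ (Permutation′ (suc (suc k))) λ π′ →
      (∀ i → π′ ⟨$⟩ʳ i ≡ prepend a π i) × UpDown π′ × Avoids4123 π′
lemma3p1 k π du av a a≤π₁ =
  prepend-perm a π , prepend-perm-≗ a π , upDown a≤π₁ du , avoids a≤π₁ av
  where open Prepended a π (prepend-perm a π) (prepend-perm-≗ a π)
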